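{- For all integers $a \geq 2$, \[ 16a^2-12a+6 \leq N(a,2a-1;2) \leq \begin{cases} 16a^3-2a^2+4a-3 & \text{if } a \text{ is even},\\ 16a^3+14a^2+2a-3 & \text{if } a \text{ is odd}. \end{cases} \]
   Context: $\mathbf{N}=\{1,2,3,\dots\}$ and $[1,n]=\{1,2,\dots,n\}$. For integers $1 \leq a \leq b$, an $(a,b)$-triple is a set of the form $\{x,ax+d,bx+2d\}$ with $x,d \in \mathbf{N}$. $N(a,b;r)$ is the least positive integer, if it exists, such that every $r$-coloring of $[1,N(a,b;r)]$ contains a monochromatic $(a,b)$-triple. -}

module Defs where

open import Data.Nat using (ℕ; zero; suc; _+_; _*_; _∸_; _≤_; _<_; _%_)
open import Data.Fin using (Fin)
open import Data.Product using (Σ; _×_; ∃-syntax)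
open import Relation.Binary.PropositionalEquality using (_≡_)
open import Relation.Nullary using (¬_)

-- An r-coloring of [1,n]: only the values on 1..n matter.
Coloring : ℕ → Set
Coloring r = ℕ → Fin r

HasMonoTriple : (a b r n : ℕ) → Coloring r → Set
HasMonoTriple a b r n c =
  ∃[ x ] ∃[ d ] (1 ≤ x × 1 ≤ d × b * x + 2 * d ≤ n ×
                 c x ≡ c (a * x + d) × c x ≡ c (b * x + 2 * d))

Forces : (a b r n : ℕ) → Set
Forces a b r n = (c : Coloring r) → HasMonoTriple a b r n c

IsN : (a b r n : ℕ) → Set
IsN a b r n = 1 ≤ n × Forces a b r n × (∀ m → 1 ≤ m → m < n → ¬ Forces a b r m)

upperBound : ℕ → ℕ
upperBound a with a % 2
... | zero = 16 * a * a * a ∸ 2 * a * a + 4 * a ∸ 3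
... | suc _ = 16 * a * a * a + 14 * a * a + 2 * a ∸ 3

-- For b = 2a − 1 the triple {x, ax + d, bx + 2d} is the progression x, x + D, x + 2D with
-- D = (a − 1)x + d: the (a, b)-triples are the 3-term progressions with D > (a − 1)x.
--
-- Lower bound: colour [1, 16a² − 12a + 5] red, blue, red, blue on the blocks ending at 2a, 4a²,
-- 8a² − 2a + 1 and 16a² − 12a + 5; comparing the blocks of x, x + D and x + 2D shows that no
-- such progression is monochromatic.
--
-- Upper bound: let c be a 2-colouring of [1, 16a² + 10a − 9] without one. The odd numbers
-- 1, 3, …, 2a + 3 contain a progression of even difference D with a − 1 < D ≤ a + 1, so some odd
-- x ≤ 2a + 1 has c(x) ≠ c(s) for s = x + 2. For D > (a − 1)s the point s + D is the middle of
-- both s, s + D, s + 2D and x, s + D, s + 2D + 2; so once s + 2E has the colour of s, so do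
-- s + 2E + 2, s + 2E + 4, …, s + 4E, and s, s + 2E, s + 4E is monochromatic. Such an E ≤ 2(a − 1)s + 3
-- is found by probing s + 2(a − 1)s + 2.
--
-- Whether [1, n] is forced is decidable, so N(a, 2a − 1; 2) exists as the least forced n; the
-- quadratic upper bound obtained is below the cubic one stated.

module Submission where

open import Defs
open import Data.Nat using (ℕ; zero; suc; _+_; _*_; _∸_; _≤_; _<_; _%_; _⊓_; s≤s; z≤n; s≤s⁻¹; _≤?_; >-nonZero; +-rawMagma)
open import Data.Nat.Properties hiding (0≢1+n)
open import Data.Nat.Induction using (<-rec)
open import Data.Nat.Tactic.RingSolver using (solve-∀)
open import Algebra.Definitions.RawMagma +-rawMagma using (_,_)
open import Data.Fin using (Fin; zero; suc; toℕ; fromℕ<)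
open import Data.Fin.Properties using (all?; toℕ-fromℕ<; 0≢1+n) renaming (_≟_ to _≟ᶠ_)
open import Data.Vec using (Vec; []; _∷_; lookup; tabulate)
open import Data.Vec.Properties using (lookup∘tabulate)
open import Data.Product using (_×_; ∃-syntax; _,_)
open import Data.Sum using (_⊎_; inj₁; inj₂)
open import Data.Empty using (⊥; ⊥-elim)
open import Function using (_∘_; _$_; case_of_)
open import Relation.Nullary using (¬_; Dec; yes; no)
open import Relation.Nullary.Decidable using (_×-dec_; map′; decidable-stable)
open import Relation.Unary using (Decidable)
open import Relation.Binary.Definitions using (DecidableEquality)
open import Relation.Binary.PropositionalEquality using (_≡_; _≢_; refl; sym; trans; cong; subst; module ≡-Reasoning)

private
  variable
    a b k r m n N : ℕ

Forces-mono : m ≤ n → Forces a b r m → Forces a b r n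
Forces-mono m≤n F c with F c
... | x , d , 1≤x , 1≤d , t≤m , cx≡cy , cx≡cz = x , d , 1≤x , 1≤d , ≤-trans t≤m m≤n , cx≡cy , cx≡cz

module _ (1≤a : 1 ≤ a) (a≤b : a ≤ b) (x d : ℕ) where

  x≤ax+d : x ≤ a * x + d
  x≤ax+d = ≤-trans (m≤n*m x a {{>-nonZero 1≤a}}) (m≤m+n (a * x) d)

  ax+d≤bx+2d : a * x + d ≤ b * x + 2 * d
  ax+d≤bx+2d = +-mono-≤ (*-monoˡ-≤ x a≤b) (m≤m+n d (d + 0))

HasMonoTriple-cong : 1 ≤ a → a ≤ b → {c c′ : Coloring r} → (∀ {i} → i ≤ n → c i ≡ c′ i) →
                     HasMonoTriple a b r n c → HasMonoTriple a b r n c′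
HasMonoTriple-cong {a} {n = n} 1≤a a≤b c≗c′ (x , d , 1≤x , 1≤d , t≤n , cx≡cy , cx≡cz) =
  x , d , 1≤x , 1≤d , t≤n ,
  trans (sym (c≗c′ x≤n)) (trans cx≡cy (c≗c′ y≤n)) ,
  trans (sym (c≗c′ x≤n)) (trans cx≡cz (c≗c′ t≤n))
  where
  y≤n : a * x + d ≤ n
  y≤n = ≤-trans (ax+d≤bx+2d 1≤a a≤b x d) t≤n
  x≤n : x ≤ n
  x≤n = ≤-trans (x≤ax+d 1≤a a≤b x d) y≤n

HasMonoTriple? : 1 ≤ b → (c : Coloring r) → Dec (HasMonoTriple a b r n c)
HasMonoTriple? {b} {r} {a} {n} 1≤b c =
  map′ (λ (x , _ , d , _ , t) → x , d , t) bounded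
       (anyUpTo? (λ x → anyUpTo? (Triple? x) (suc n)) (suc n))
  where
  Triple : ℕ → ℕ → Set
  Triple x d = 1 ≤ x × 1 ≤ d × b * x + 2 * d ≤ n × c x ≡ c (a * x + d) × c x ≡ c (b * x + 2 * d)
  Triple? : ∀ x d → Dec (Triple x d)
  Triple? x d = 1 ≤? x ×-dec 1 ≤? d ×-dec b * x + 2 * d ≤? n ×-dec
                c x ≟ᶠ c (a * x + d) ×-dec c x ≟ᶠ c (b * x + 2 * d)
  bounded : HasMonoTriple a b r n c → ∃[ x ] (x < suc n × ∃[ d ] (d < suc n × Triple x d))
  bounded (x , d , t@(_ , _ , t≤n , _)) =
    x , s≤s (≤-trans (x≤ax+d 1≤b ≤-refl x d) y≤n) ,
    d , s≤s (≤-trans (m≤n+m d (b * x)) y≤n) , t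
    where
    y≤n : b * x + d ≤ n
    y≤n = ≤-trans (ax+d≤bx+2d 1≤b ≤-refl x d) t≤n

∀-Vec? : ∀ k {P : Vec (Fin r) k → Set} → (∀ v → Dec (P v)) → Dec (∀ v → P v)
∀-Vec? zero    P? = map′ (λ p → λ { [] → p }) (_$ []) (P? [])
∀-Vec? (suc k) P? = map′ (λ p → λ { (i ∷ v) → p i v }) (λ p i v → p (i ∷ v))
                         (all? λ i → ∀-Vec? k (λ v → P? (i ∷ v)))

restrict : ∀ n → Coloring r → Vec (Fin r) (suc n)
restrict n c = tabulate (c ∘ toℕ)

extend : ∀ {n} → Vec (Fin r) (suc n) → Coloring r
extend {n = n} v i = lookup v (fromℕ< (s≤s (m⊓n≤n i n)))

extend-restrict : ∀ n (c : Coloring r) {i} → i ≤ n → extend (restrict n c) i ≡ c i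
extend-restrict n c {i} i≤n = begin
  lookup (tabulate (c ∘ toℕ)) (fromℕ< i⊓n<1+n) ≡⟨ lookup∘tabulate (c ∘ toℕ) (fromℕ< i⊓n<1+n) ⟩
  c (toℕ (fromℕ< i⊓n<1+n))                     ≡⟨ cong c (toℕ-fromℕ< i⊓n<1+n) ⟩
  c (i ⊓ n)                                    ≡⟨ cong c (m≤n⇒m⊓n≡m i≤n) ⟩
  c i                                          ∎
  where
  open ≡-Reasoning
  i⊓n<1+n : i ⊓ n < suc n
  i⊓n<1+n = s≤s (m⊓n≤n i n)

Forces? : 1 ≤ a → a ≤ b → Dec (Forces a b r n)
Forces? {a} {n = n} 1≤a a≤b =
  map′ (λ p c → HasMonoTriple-cong 1≤a a≤b (extend-restrict n c) (p (restrict n c)))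
       (λ F v → F (extend {n = n} v))
       (∀-Vec? (suc n) (λ v → HasMonoTriple? {a = a} (≤-trans 1≤a a≤b) (extend {n = n} v)))

least-satisfying : {P : ℕ → Set} → Decidable P → ∀ n → P n → ∃[ m ] (P m × (∀ {k} → k < m → ¬ P k))
least-satisfying P? = <-rec _ λ n smaller Pn → case anyUpTo? P? n of λ where
  (yes (m , m<n , Pm)) → smaller m<n Pm
  (no none)            → n , Pn , λ k<n Pk → none (_ , k<n , Pk)

IsN-exists : 1 ≤ a → a ≤ b → 1 ≤ n → Forces a b r n → ∃[ N ] (IsN a b r N × N ≤ n)
IsN-exists {n = n} 1≤a a≤b 1≤n Fn with
  least-satisfying (λ m → 1 ≤? m ×-dec Forces? 1≤a a≤b) n (1≤n , Fn)
... | N , (1≤N , FN) , minimal =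
  N , (1≤N , FN , λ m 1≤m m<N Fm → minimal m<N (1≤m , Fm)) , ≮⇒≥ λ n<N → minimal n<N (1≤n , Fn)

IsN-above-non-forcing : IsN a b r N → ¬ Forces a b r m → m < N
IsN-above-non-forcing {a} {b} {r} (_ , FN , _) ¬Fm = ≰⇒> λ N≤m → ¬Fm (Forces-mono {a = a} {b} {r} N≤m FN)

MonoProgression : (k r n : ℕ) → Coloring r → Set
MonoProgression k r n c =
  ∃[ x ] ∃[ D ] (1 ≤ x × k * x < D × x + 2 * D ≤ n × c x ≡ c (x + D) × c x ≡ c (x + 2 * D))

triple-middle : ∀ k x d → suc k * x + d ≡ x + (k * x + d)
triple-middle k x d = +-assoc x (k * x) d

triple-last : ∀ k x d → suc (2 * k) * x + 2 * d ≡ x + 2 * (k * x + d)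
triple-last = solve-∀

triple⇒progression : {c : Coloring r} → HasMonoTriple (suc k) (suc (2 * k)) r n c → MonoProgression k r n c
triple⇒progression {k = k} {n = n} {c} (x , d , 1≤x , 1≤d , t≤n , cx≡cy , cx≡cz) =
  x , k * x + d , 1≤x , m<m+n (k * x) 1≤d , subst (_≤ n) (triple-last k x d) t≤n ,
  trans cx≡cy (cong c (triple-middle k x d)) , trans cx≡cz (cong c (triple-last k x d))

progression⇒triple : {c : Coloring r} → MonoProgression k r n c → HasMonoTriple (suc k) (suc (2 * k)) r n c
progression⇒triple {k = k} {n = n} {c} (x , D , 1≤x , kx<D , t≤n , cx≡cy , cx≡cz) =
  x , d , 1≤x , m<n⇒0<n∸m kx<D , subst (_≤ n) (sym last≡) t≤n ,
  trans cx≡cy (cong c (sym middle≡)) , trans cx≡cz (cong c (sym last≡))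
  where
  d : ℕ
  d = D ∸ k * x
  D≡ : k * x + d ≡ D
  D≡ = m+[n∸m]≡n (<⇒≤ kx<D)
  middle≡ : suc k * x + d ≡ x + D
  middle≡ = trans (triple-middle k x d) (cong (x +_) D≡)
  last≡ : suc (2 * k) * x + 2 * d ≡ x + 2 * D
  last≡ = trans (triple-last k x d) (cong (λ e → x + 2 * e) D≡)

fin2-≢-≢⇒≡ : {u v w : Fin 2} → u ≢ w → v ≢ w → u ≡ v
fin2-≢-≢⇒≡ {zero}     {zero}     _   _   = refl
fin2-≢-≢⇒≡ {suc zero} {suc zero} _   _   = refl
fin2-≢-≢⇒≡ {zero}     {suc zero} {zero}     u≢w _   = ⊥-elim (u≢w refl)
fin2-≢-≢⇒≡ {zero}     {suc zero} {suc zero} _   v≢w = ⊥-elim (v≢w refl)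
fin2-≢-≢⇒≡ {suc zero} {zero}     {zero}     _   v≢w = ⊥-elim (v≢w refl)
fin2-≢-≢⇒≡ {suc zero} {zero}     {suc zero} u≢w _   = ⊥-elim (u≢w refl)

constant-or-jump : {A : Set} → DecidableEquality A → (f : ℕ → A) → ∀ K →
                   (∀ {j} → j ≤ K → f j ≡ f 0) ⊎ ∃[ j ] (j < K × f j ≢ f (suc j))
constant-or-jump _≟_ f zero = inj₁ λ { z≤n → refl }
constant-or-jump _≟_ f (suc K) with constant-or-jump _≟_ f K
... | inj₂ (j , j<K , jump) = inj₂ (j , m<n⇒m<1+n j<K , jump)
... | inj₁ constant with f K ≟ f (suc K)
...   | no jump = inj₂ (K , ≤-refl , jump)
...   | yes step = inj₁ extended
  where
  extended : ∀ {j} → j ≤ suc K → f j ≡ f 0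
  extended j≤1+K with m≤n⇒m<n∨m≡n j≤1+K
  ... | inj₁ j<1+K = constant (s≤s⁻¹ j<1+K)
  ... | inj₂ refl  = trans (sym step) (constant ≤-refl)

even-between : ∀ k → ∃[ h ] (k < 2 * h × 2 * h ≤ 2 + k)
even-between zero = 1 , s≤s z≤n , ≤-refl
even-between (suc zero) = 1 , ≤-refl , s≤s (s≤s z≤n)
even-between (suc (suc k)) with even-between k
... | h , k<2h , 2h≤2+k =
  suc h , subst (2 + k <_) (sym (*-suc 2 h)) (+-monoʳ-< 2 k<2h) ,
          subst (_≤ 4 + k) (sym (*-suc 2 h)) (+-monoʳ-≤ 2 2h≤2+k)

-- The hypothesis of jump-impossible for the largest starting point s = 3 + 2(k + 1).
upperN : ℕ → ℕ
upperN k = (1 + 8 * k) * (3 + 2 * suc k) + 12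

module WithoutMonoProgression {k n : ℕ} {c : Coloring 2} (noAP : ¬ MonoProgression k 2 n c) where

  not-mono : ∀ {x D} → 1 ≤ x → k * x < D → x + 2 * D ≤ n → c x ≡ c (x + D) → c x ≢ c (x + 2 * D)
  not-mono 1≤x kx<D t≤n cx≡cy cx≡cz = noAP (_ , _ , 1≤x , kx<D , t≤n , cx≡cy , cx≡cz)

  module Jump (x : ℕ) (1≤x : 1 ≤ x) (cx≢cs : c x ≢ c (2 + x)) where

    s : ℕ
    s = 2 + x

    -- s + D is also the middle of the progression x, s + D, s + 2(D + 1) of difference D + 2.
    via-x : ∀ {D} → k * s < D → s + 2 * suc D ≤ n → c (s + D) ≡ c x → c (s + 2 * suc D) ≡ c s
    via-x {D} ks<D t≤n csD≡cx = fin2-≢-≢⇒≡ last≢cx (λ e → cx≢cs (sym e))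
      where
      middle≡ : ∀ x D → x + (2 + D) ≡ 2 + x + D
      middle≡ = solve-∀
      last≡ : ∀ x D → x + 2 * (2 + D) ≡ 2 + x + 2 * suc D
      last≡ = solve-∀
      kx<2+D : k * x < 2 + D
      kx<2+D = ≤-trans (s≤s (*-monoʳ-≤ k (m≤n+m x 2))) (≤-trans ks<D (m≤n+m D 2))
      last≢cx : c (s + 2 * suc D) ≢ c x
      last≢cx e = not-mono 1≤x kx<2+D (subst (_≤ n) (sym (last≡ x D)) t≤n)
                    (trans (sym csD≡cx) (cong c (sym (middle≡ x D))))
                    (trans (sym e) (cong c (sym (last≡ x D))))

    propagate-step : ∀ {D} → k * s < D → s + 2 * suc D ≤ n → c (s + 2 * D) ≡ c s → c (s + 2 * suc D) ≡ c s
    propagate-step {D} ks<D t≤n cz≡cs = via-x ks<D t≤n (fin2-≢-≢⇒≡ middle≢cs cx≢cs)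
      where
      middle≢cs : c (s + D) ≢ c s
      middle≢cs e = not-mono (s≤s z≤n) ks<D (≤-trans (+-monoʳ-≤ s (*-monoʳ-≤ 2 (n≤1+n D))) t≤n)
                      (sym e) (sym cz≡cs)

    propagate : ∀ j {D} → k * s < D → s + 2 * (j + D) ≤ n → c (s + 2 * D) ≡ c s → c (s + 2 * (j + D)) ≡ c s
    propagate zero        _    _   cz≡cs = cz≡cs
    propagate (suc j) {D} ks<D t≤n cz≡cs =
      propagate-step (≤-trans ks<D (m≤n+m D j)) t≤n
        (propagate j ks<D (≤-trans (+-monoʳ-≤ s (*-monoʳ-≤ 2 (n≤1+n (j + D)))) t≤n) cz≡cs)

    no-doubling : ∀ {E} → k * s < E → s + 2 * (E + E) ≤ n → c (s + 2 * E) ≢ c s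
    no-doubling {E} ks<E t≤n cz≡cs =
      not-mono (s≤s z≤n) (≤-trans ks<E (m≤m+n E (E + 0))) (subst (λ t → s + 2 * t ≤ n) E+E≡2E t≤n)
        (sym cz≡cs) (sym (subst (λ t → c (s + 2 * t) ≡ c s) E+E≡2E (propagate E ks<E t≤n cz≡cs)))
      where
      E+E≡2E : E + E ≡ 2 * E
      E+E≡2E = cong (E +_) (sym (+-identityʳ E))

    D₀ E : ℕ
    D₀ = suc (k * s)
    E  = suc (2 * D₀)

    reach≤n : (1 + 8 * k) * s + 12 ≤ n → s + 2 * (E + E) ≤ n
    reach≤n = subst (_≤ n) (sym (reach≡ k s))
      where
      reach≡ : ∀ k s → s + 2 * (suc (2 * suc (k * s)) + suc (2 * suc (k * s))) ≡ (1 + 8 * k) * s + 12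
      reach≡ = solve-∀

    -- If the probe s + 2D₀ does not have the colour of s, it is the middle of x, s + 2D₀, s + 2E.
    jump-impossible : ¬ (1 + 8 * k) * s + 12 ≤ n
    jump-impossible t≤n with c (s + 2 * D₀) ≟ᶠ c s
    ... | yes cz≡cs =
      no-doubling ≤-refl (≤-trans (+-monoʳ-≤ s (*-monoʳ-≤ 2 (+-mono-≤ D₀≤E D₀≤E))) (reach≤n t≤n)) cz≡cs
      where
      D₀≤E : D₀ ≤ E
      D₀≤E = ≤-trans (m≤m+n D₀ (D₀ + 0)) (n≤1+n (2 * D₀))
    ... | no  cz≢cs =
      no-doubling (s≤s (≤-trans (n≤1+n (k * s)) (m≤m+n D₀ (D₀ + 0)))) (reach≤n t≤n)
        (via-x (m≤m+n D₀ (D₀ + 0)) (≤-trans (+-monoʳ-≤ s (*-monoʳ-≤ 2 (m≤m+n E E))) (reach≤n t≤n))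
           (fin2-≢-≢⇒≡ cz≢cs cx≢cs))

  upperN≰n : ¬ upperN k ≤ n
  upperN≰n N≤n with constant-or-jump _≟ᶠ_ (λ j → c (1 + 2 * j)) (2 + k) | even-between k
  ... | inj₁ constant | h , k<2h , 2h≤2+k =
    not-mono (s≤s z≤n) (subst (_< 2 * h) (sym (*-identityʳ k)) k<2h) last≤n
      (sym (constant (≤-trans (m≤m+n h (h + 0)) 2h≤2+k))) (sym (constant 2h≤2+k))
    where
    1+2[2+k]≡ : ∀ k → 1 + 2 * (2 + k) ≡ 3 + 2 * suc k
    1+2[2+k]≡ = solve-∀
    last≤n : 1 + 2 * (2 * h) ≤ n
    last≤n = ≤-trans (+-monoʳ-≤ 1 (*-monoʳ-≤ 2 2h≤2+k))
               (≤-trans (≤-reflexive (1+2[2+k]≡ k)) (≤-trans (m≤m+n _ _) (≤-trans (m≤m+n _ 12) N≤n)))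
  ... | inj₂ (j , j<2+k , jump) | _ =
    Jump.jump-impossible (1 + 2 * j) (s≤s z≤n) (λ e → jump (trans e (cong c (next-odd j))))
      (≤-trans (+-monoˡ-≤ 12 (*-monoʳ-≤ (1 + 8 * k) (s≤s (s≤s (s≤s (*-monoʳ-≤ 2 (s≤s⁻¹ j<2+k))))))) N≤n)
    where
    next-odd : ∀ j → 2 + (1 + 2 * j) ≡ 1 + 2 * suc j
    next-odd = solve-∀

upper-bound : ∀ k → Forces (suc k) (suc (2 * k)) 2 (upperN k)
upper-bound k c = decidable-stable (HasMonoTriple? {b = suc (2 * k)} {a = suc k} (s≤s z≤n) c) λ ¬triple →
  WithoutMonoProgression.upperN≰n {k} {upperN k} {c} (λ ap → ¬triple (progression⇒triple {k = k} ap)) ≤-refl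

-- For a = k + 1 the block ends are 2a, 4a², 8a² − 2a + 1 and M = 16a² − 12a + 5.
module FourBlocks (k : ℕ) where

  t₁ t₂ t₃ M : ℕ
  t₁ = 2 * k + 2
  t₂ = 4 * k * k + 8 * k + 4
  t₃ = 8 * k * k + 14 * k + 7
  M  = 16 * k * k + 20 * k + 9

  t₁≤t₂ : t₁ ≤ t₂
  t₁≤t₂ = ≤″⇒≤ (_ , poly k)
    where
    poly : ∀ k → 2 * k + 2 + (4 * k * k + 6 * k + 2) ≡ 4 * k * k + 8 * k + 4
    poly = solve-∀

  t₂≤t₃ : t₂ ≤ t₃
  t₂≤t₃ = ≤″⇒≤ (_ , poly k)
    where
    poly : ∀ k → 4 * k * k + 8 * k + 4 + (4 * k * k + 6 * k + 3) ≡ 8 * k * k + 14 * k + 7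
    poly = solve-∀

  data Block (i : ℕ) : Set where
    first  : i ≤ t₁ → Block i
    second : t₁ < i → i ≤ t₂ → Block i
    third  : t₂ < i → i ≤ t₃ → Block i
    fourth : t₃ < i → Block i

  block : ∀ i → Block i
  block i with i ≤? t₁ | i ≤? t₂ | i ≤? t₃
  ... | yes i≤t₁ | _        | _        = first i≤t₁
  ... | no  i≰t₁ | yes i≤t₂ | _        = second (≰⇒> i≰t₁) i≤t₂
  ... | no  _    | no  i≰t₂ | yes i≤t₃ = third (≰⇒> i≰t₂) i≤t₃
  ... | no  _    | no  _    | no  i≰t₃ = fourth (≰⇒> i≰t₃)

  red blue : Fin 2
  red  = zero
  blue = suc zero

  paint : ∀ {i} → Block i → Fin 2
  paint (first _)    = red
  paint (second _ _) = blue
  paint (third _ _)  = red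
  paint (fourth _)   = blue

  colour : Coloring 2
  colour i = paint (block i)

  -- Stated for paint (block i) rather than colour i so that `with block i` can abstract it.
  colour-first : ∀ {i} → i ≤ t₁ → paint (block i) ≡ red
  colour-first {i} i≤t₁ with block i
  ... | first _        = refl
  ... | second t₁<i _  = ⊥-elim (<⇒≱ t₁<i i≤t₁)
  ... | third _ _      = refl
  ... | fourth t₃<i    = ⊥-elim (<⇒≱ t₃<i (≤-trans i≤t₁ (≤-trans t₁≤t₂ t₂≤t₃)))

  colour-second : ∀ {i} → t₁ < i → i ≤ t₂ → paint (block i) ≡ blue
  colour-second {i} t₁<i i≤t₂ with block i
  ... | first i≤t₁     = ⊥-elim (<⇒≱ t₁<i i≤t₁)
  ... | second _ _     = refl
  ... | third t₂<i _   = ⊥-elim (<⇒≱ t₂<i i≤t₂)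
  ... | fourth _       = refl

  colour-third : ∀ {i} → t₂ < i → i ≤ t₃ → paint (block i) ≡ red
  colour-third {i} t₂<i i≤t₃ with block i
  ... | first _        = refl
  ... | second _ i≤t₂  = ⊥-elim (<⇒≱ t₂<i i≤t₂)
  ... | third _ _      = refl
  ... | fourth t₃<i    = ⊥-elim (<⇒≱ t₃<i i≤t₃)

  colour-fourth : ∀ {i} → t₃ < i → paint (block i) ≡ blue
  colour-fourth {i} t₃<i with block i
  ... | first i≤t₁     = ⊥-elim (<⇒≱ t₃<i (≤-trans i≤t₁ (≤-trans t₁≤t₂ t₂≤t₃)))
  ... | second _ _     = refl
  ... | third _ i≤t₃   = ⊥-elim (<⇒≱ t₃<i i≤t₃)
  ... | fourth _       = refl

  clash : ∀ {i j} → colour i ≡ red → colour j ≡ blue → colour i ≢ colour j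
  clash ci≡red cj≡blue ci≡cj = 0≢1+n (trans (sym ci≡red) (trans ci≡cj cj≡blue))

  module Progression (1≤k : 1 ≤ k) (x D : ℕ) (1≤x : 1 ≤ x) (kx<D : k * x < D) where

    y z : ℕ
    y = x + D
    z = x + 2 * D

    x+x<y : x + x < y
    x+x<y = +-monoʳ-< x (≤-<-trans (m≤n*m x k {{>-nonZero 1≤k}}) kx<D)

    x<y : x < y
    x<y = ≤-<-trans (m≤m+n x x) x+x<y

    x+z≡y+y : x + z ≡ y + y
    x+z≡y+y = poly x D
      where
      poly : ∀ x D → x + (x + 2 * D) ≡ x + D + (x + D)
      poly = solve-∀

    z-from : ∀ {u} → u ≤ x → u + 2 * suc (k * u) ≤ z
    z-from u≤x = +-mono-≤ u≤x (*-monoʳ-≤ 2 (≤-trans (s≤s (*-monoʳ-≤ k u≤x)) kx<D))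

    t₁<z : t₁ < z
    t₁<z = subst (_≤ z) (sym (poly k)) (z-from 1≤x)
      where
      poly : ∀ k → suc (2 * k + 2) ≡ 1 + 2 * suc (k * 1)
      poly = solve-∀

    t₂<x⇒t₃<y : t₂ < x → t₃ < y
    t₂<x⇒t₃<y t₂<x = ≤-trans (≤″⇒≤ (_ , poly k)) (≤-trans (+-mono-≤ t₂<x t₂<x) (<⇒≤ x+x<y))
      where
      poly : ∀ k → suc (8 * k * k + 14 * k + 7) + (2 * k + 2) ≡ suc (4 * k * k + 8 * k + 4) + suc (4 * k * k + 8 * k + 4)
      poly = solve-∀

    t₃<x⇒M<z : t₃ < x → M < z
    t₃<x⇒M<z t₃<x = begin
      suc M                            ≤⟨ ≤″⇒≤ (_ , poly k) ⟩
      suc t₃ + 2 * suc (suc t₃)        ≤⟨ +-mono-≤ t₃<x (*-monoʳ-≤ 2 (s≤s t₃<x)) ⟩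
      x + 2 * suc x                    ≤⟨ +-monoʳ-≤ x (*-monoʳ-≤ 2 (s≤s (m≤n*m x k {{>-nonZero 1≤k}}))) ⟩
      x + 2 * suc (k * x)              ≤⟨ z-from ≤-refl ⟩
      z                                ∎
      where
      open ≤-Reasoning
      poly : ∀ k → suc (16 * k * k + 20 * k + 9) + (8 * k * k + 22 * k + 16)
              ≡ suc (8 * k * k + 14 * k + 7) + 2 * suc (suc (8 * k * k + 14 * k + 7))
      poly = solve-∀

    y≤t₁⇒z≤t₂ : y ≤ t₁ → z ≤ t₂
    y≤t₁⇒z≤t₂ y≤t₁ = begin
      z       ≤⟨ m≤n+m z x ⟩
      x + z   ≡⟨ x+z≡y+y ⟩
      y + y   ≤⟨ +-mono-≤ y≤t₁ y≤t₁ ⟩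
      t₁ + t₁ ≤⟨ ≤″⇒≤ (_ , poly k) ⟩
      t₂      ∎
      where
      open ≤-Reasoning
      poly : ∀ k → 2 * k + 2 + (2 * k + 2) + (4 * k * k + 4 * k) ≡ 4 * k * k + 8 * k + 4
      poly = solve-∀

    x≤t₁⇒t₂<y⇒t₃<z : x ≤ t₁ → t₂ < y → t₃ < z
    x≤t₁⇒t₂<y⇒t₃<z x≤t₁ t₂<y = +-cancelʳ-≤ t₁ (suc t₃) z (begin
      suc t₃ + t₁     ≡⟨ poly k ⟩
      suc t₂ + suc t₂ ≤⟨ +-mono-≤ t₂<y t₂<y ⟩
      y + y           ≡⟨ x+z≡y+y ⟨
      x + z           ≤⟨ +-monoˡ-≤ z x≤t₁ ⟩
      t₁ + z          ≡⟨ +-comm t₁ z ⟩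
      z + t₁          ∎)
      where
      open ≤-Reasoning
      poly : ∀ k → suc (8 * k * k + 14 * k + 7) + (2 * k + 2) ≡ suc (4 * k * k + 8 * k + 4) + suc (4 * k * k + 8 * k + 4)
      poly = solve-∀

    t₁<x⇒t₂<z : t₁ < x → t₂ < z
    t₁<x⇒t₂<z t₁<x = subst (_≤ z) (sym (poly k)) (z-from t₁<x)
      where
      poly : ∀ k → suc (4 * k * k + 8 * k + 4) ≡ suc (2 * k + 2) + 2 * suc (k * suc (2 * k + 2))
      poly = solve-∀

    t₁<x⇒y≤t₂⇒z≤t₃ : t₁ < x → y ≤ t₂ → z ≤ t₃
    t₁<x⇒y≤t₂⇒z≤t₃ t₁<x y≤t₂ = +-cancelʳ-≤ (suc t₁) z t₃ (begin
      z + suc t₁      ≤⟨ +-monoʳ-≤ z t₁<x ⟩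
      z + x           ≡⟨ +-comm z x ⟩
      x + z           ≡⟨ x+z≡y+y ⟩
      y + y           ≤⟨ +-mono-≤ y≤t₂ y≤t₂ ⟩
      t₂ + t₂         ≤⟨ ≤″⇒≤ (_ , poly k) ⟩
      t₃ + suc t₁     ∎)
      where
      open ≤-Reasoning
      poly : ∀ k → 4 * k * k + 8 * k + 4 + (4 * k * k + 8 * k + 4) + 2 ≡ 8 * k * k + 14 * k + 7 + suc (2 * k + 2)
      poly = solve-∀

    t₃<y⇒M<z : t₃ < y → M < z
    t₃<y⇒M<z t₃<y with x ≤? 8 * k + 6
    ... | yes x≤8k+6 = +-cancelʳ-≤ (8 * k + 6) (suc M) z (begin
      suc M + (8 * k + 6) ≡⟨ poly k ⟩
      suc t₃ + suc t₃     ≤⟨ +-mono-≤ t₃<y t₃<y ⟩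
      y + y               ≡⟨ x+z≡y+y ⟨
      x + z               ≤⟨ +-monoˡ-≤ z x≤8k+6 ⟩
      8 * k + 6 + z       ≡⟨ +-comm (8 * k + 6) z ⟩
      z + (8 * k + 6)     ∎)
      where
      open ≤-Reasoning
      poly : ∀ k → suc (16 * k * k + 20 * k + 9) + (8 * k + 6) ≡ suc (8 * k * k + 14 * k + 7) + suc (8 * k * k + 14 * k + 7)
      poly = solve-∀
    ... | no x≰8k+6 = ≤-trans (1+M≤z-beyond k 1≤k) (z-from (≰⇒> x≰8k+6))
      where
      poly : ∀ j → suc (16 * suc j * suc j + 20 * suc j + 9) + (2 * j + 1)
              ≡ suc (8 * suc j + 6) + 2 * suc (suc j * suc (8 * suc j + 6))
      poly = solve-∀
      1+M≤z-beyond : ∀ k → 1 ≤ k → suc (16 * k * k + 20 * k + 9) ≤ suc (8 * k + 6) + 2 * suc (k * suc (8 * k + 6))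
      1+M≤z-beyond (suc j) _ = ≤″⇒≤ (_ , poly j)

    no-mono : z ≤ M → colour x ≡ colour y → colour x ≡ colour z → ⊥
    no-mono z≤M cx≡cy cx≡cz = by-blocks (block x) (block y)
      where
      by-blocks : Block x → Block y → ⊥
      by-blocks (fourth t₃<x) _ = <⇒≱ (t₃<x⇒M<z t₃<x) z≤M
      by-blocks (third t₂<x x≤t₃) _ =
        clash (colour-third t₂<x x≤t₃) (colour-fourth (t₂<x⇒t₃<y t₂<x)) cx≡cy
      by-blocks (first x≤t₁) (first y≤t₁) =
        clash (colour-first x≤t₁) (colour-second t₁<z (y≤t₁⇒z≤t₂ y≤t₁)) cx≡cz
      by-blocks (first x≤t₁) (second t₁<y y≤t₂) =
        clash (colour-first x≤t₁) (colour-second t₁<y y≤t₂) cx≡cy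
      by-blocks (first x≤t₁) (third t₂<y _) =
        clash (colour-first x≤t₁) (colour-fourth (x≤t₁⇒t₂<y⇒t₃<z x≤t₁ t₂<y)) cx≡cz
      by-blocks (first x≤t₁) (fourth t₃<y) =
        clash (colour-first x≤t₁) (colour-fourth (x≤t₁⇒t₂<y⇒t₃<z x≤t₁ (≤-<-trans t₂≤t₃ t₃<y))) cx≡cz
      by-blocks (second t₁<x _) (first y≤t₁) = <⇒≱ (<-trans t₁<x x<y) y≤t₁
      by-blocks (second t₁<x x≤t₂) (second _ y≤t₂) =
        clash (colour-third (t₁<x⇒t₂<z t₁<x) (t₁<x⇒y≤t₂⇒z≤t₃ t₁<x y≤t₂))
              (colour-second t₁<x x≤t₂) (sym cx≡cz)
      by-blocks (second t₁<x x≤t₂) (third t₂<y y≤t₃) =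
        clash (colour-third t₂<y y≤t₃) (colour-second t₁<x x≤t₂) (sym cx≡cy)
      by-blocks (second _ _) (fourth t₃<y) = <⇒≱ (t₃<y⇒M<z t₃<y) z≤M

  not-forces : 1 ≤ k → ¬ Forces (suc k) (suc (2 * k)) 2 M
  not-forces 1≤k F with triple⇒progression {k = k} (F colour)
  ... | x , D , 1≤x , kx<D , z≤M , cx≡cy , cx≡cz = Progression.no-mono 1≤k x D 1≤x kx<D z≤M cx≡cy cx≡cz

IsN-between : ∀ k → 1 ≤ k → ∃[ N ] (IsN (suc k) (suc (2 * k)) 2 N × FourBlocks.M k < N × N ≤ upperN k)
IsN-between k 1≤k =
  let N , isN , N≤upperN = IsN-exists {suc k} {suc (2 * k)} (s≤s z≤n) (s≤s (m≤m+n k (k + 0))) 1≤upperN (upper-bound k)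
  in N , isN , IsN-above-non-forcing {suc k} {suc (2 * k)} isN (FourBlocks.not-forces k 1≤k) , N≤upperN
  where
  1≤upperN : 1 ≤ upperN k
  1≤upperN = ≤-trans (s≤s z≤n) (m≤n+m 12 ((1 + 8 * k) * (3 + 2 * suc k)))

2*[1+n]∸1≡1+2n : ∀ n → 2 * suc n ∸ 1 ≡ suc (2 * n)
2*[1+n]∸1≡1+2n n = cong (_∸ 1) (*-suc 2 n)

lower-≡ : ∀ k → 16 * suc k * suc k ∸ 12 * suc k + 6 ≡ suc (16 * k * k + 20 * k + 9)
lower-≡ k = begin
  16 * suc k * suc k ∸ 12 * suc k + 6                      ≡⟨ cong (λ t → t ∸ 12 * suc k + 6) (poly₁ k) ⟩
  12 * suc k + (16 * k * k + 20 * k + 4) ∸ 12 * suc k + 6  ≡⟨ cong (_+ 6) (m+n∸m≡n (12 * suc k) _) ⟩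
  16 * k * k + 20 * k + 4 + 6                              ≡⟨ poly₂ k ⟩
  suc (16 * k * k + 20 * k + 9)                            ∎
  where
  open ≡-Reasoning
  poly₁ : ∀ k → 16 * suc k * suc k ≡ 12 * suc k + (16 * k * k + 20 * k + 4)
  poly₁ = solve-∀
  poly₂ : ∀ k → 16 * k * k + 20 * k + 4 + 6 ≡ suc (16 * k * k + 20 * k + 9)
  poly₂ = solve-∀

≤-upperBound : ∀ {n} a → n ≤ 16 * a * a * a ∸ 2 * a * a + 4 * a ∸ 3 → n ≤ 16 * a * a * a + 14 * a * a + 2 * a ∸ 3 →
               n ≤ upperBound a
≤-upperBound a n≤even n≤odd with a % 2
... | zero  = n≤even
... | suc _ = n≤odd

upperN≤upperBound : ∀ k → 1 ≤ k → upperN k ≤ upperBound (suc k)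
upperN≤upperBound (suc m) _ =
  ≤-upperBound (2 + m) (m+n≤o⇒m≤o∸n (upperN (suc m)) even) (m+n≤o⇒m≤o∸n (upperN (suc m)) odd)
  where
  even : upperN (suc m) + 3 ≤ 16 * (2 + m) * (2 + m) * (2 + m) ∸ 2 * (2 + m) * (2 + m) + 4 * (2 + m)
  even = begin
    upperN (suc m) + 3
      ≤⟨ ≤″⇒≤ (_ , poly₂ m) ⟩
    16 * m * m * m + 94 * m * m + 184 * m + 120 + 4 * (2 + m)
      ≡⟨ cong (_+ 4 * (2 + m)) (m+n∸m≡n (2 * (2 + m) * (2 + m)) _) ⟨
    2 * (2 + m) * (2 + m) + (16 * m * m * m + 94 * m * m + 184 * m + 120) ∸ 2 * (2 + m) * (2 + m) + 4 * (2 + m)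
      ≡⟨ cong (λ t → t ∸ 2 * (2 + m) * (2 + m) + 4 * (2 + m)) (poly₁ m) ⟨
    16 * (2 + m) * (2 + m) * (2 + m) ∸ 2 * (2 + m) * (2 + m) + 4 * (2 + m) ∎
    where
    open ≤-Reasoning
    poly₁ : ∀ m → 16 * (2 + m) * (2 + m) * (2 + m) ≡ 2 * (2 + m) * (2 + m) + (16 * m * m * m + 94 * m * m + 184 * m + 120)
    poly₁ = solve-∀
    poly₂ : ∀ m → (1 + 8 * suc m) * (3 + 2 * suc (suc m)) + 12 + 3 + (16 * m * m * m + 78 * m * m + 114 * m + 50)
             ≡ 16 * m * m * m + 94 * m * m + 184 * m + 120 + 4 * (2 + m)
    poly₂ = solve-∀
  odd : upperN (suc m) + 3 ≤ 16 * (2 + m) * (2 + m) * (2 + m) + 14 * (2 + m) * (2 + m) + 2 * (2 + m)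
  odd = ≤″⇒≤ (_ , poly m)
    where
    poly : ∀ m → (1 + 8 * suc m) * (3 + 2 * suc (suc m)) + 12 + 3 + (16 * m * m * m + 94 * m * m + 176 * m + 110)
            ≡ 16 * (2 + m) * (2 + m) * (2 + m) + 14 * (2 + m) * (2 + m) + 2 * (2 + m)
    poly = solve-∀

corollary2p1 : (a : ℕ) → 2 ≤ a →
    ∃[ n ] (IsN a (2 * a ∸ 1) 2 n ×
            16 * a * a ∸ 12 * a + 6 ≤ n × n ≤ upperBound a)
corollary2p1 (suc k) (s≤s 1≤k) =
  let N , isN , M<N , N≤upperN = IsN-between k 1≤k
  in N , subst (λ b → IsN (suc k) b 2 N) (sym (2*[1+n]∸1≡1+2n k)) isN ,
     subst (_≤ N) (sym (lower-≡ k)) M<N , ≤-trans N≤upperN (upperN≤upperBound k 1≤k)
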